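{- Let $\mathcal{A}_1=\langle Q_1,\iota_1,\Sigma,\delta_1,\alpha_1\rangle$ and $\mathcal{A}_2$ be nondeterministic Büchi automata over the same alphabet $\Sigma$, let $\mathcal{A}_2^c={\sf KVMH}(\mathcal{A}_2)=\langle Q_2,\iota_2,\Sigma,\delta_2,\alpha_2\rangle$, and let $\mathcal{B}=\mathcal{A}_1\times\mathcal{A}_2^c$ be the generalized Büchi automaton with states $Q_1\times Q_2$, initial state $(\iota_1,\iota_2)$, transitions $\delta_{\mathcal{B}}((\ell_1,\ell_2),\sigma)=\delta_1(\ell_1,\sigma)\times\delta_2(\ell_2,\sigma)$, and accepting sets $\beta_1=\alpha_1\times Q_2$, $\beta_2=Q_1\times\alpha_2$. Define $(\ell_1,\ell_2)\preceq_{\sf inc}(\ell_1',\ell_2')$ iff $\ell_1=\ell_1'$ and $\ell_2\preceq_{\sf univ}\ell_2'$. Then $\preceq_{\sf inc}$ is a simulation for $\mathcal{B}$, i.e., for each $i\in\{1,2\}$ it is a simulation for the Büchi automaton with the states and transitions of $\mathcal{B}$ and accepting set $\beta_i$.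
   Context: An NBW is $\mathcal{A}=\langle Q,\iota,\Sigma,\delta,\alpha\rangle$ with finite state set $Q$, $\delta:Q\times\Sigma\to2^Q$, accepting $\alpha\subseteq Q$. For NBW $\mathcal{A}_2=\langle Q,\iota,\Sigma,\delta,\alpha\rangle$ and $k=2(|Q|-|\alpha|)$: $[k]=\{0,\dots,k\}$, $Q_k=2^{(Q\times[k])\setminus(\alpha\times\mathbb{N}^{odd})}$ ($\mathbb{N}^{odd}$ odd naturals), $\mathsf{odd}=Q\times[k]^{odd}$. ${\sf KVMH}(\mathcal{A}_2)$ is the NBW with states $Q_k\times Q_k$, initial state $(\{(\iota,k)\},\emptyset)$, accepting states $Q_k\times\{\emptyset\}$, and transitions: if $o\neq\emptyset$, $\delta'(\langle s,o\rangle,\sigma)$ is the set of $\langle s',o'\setminus\mathsf{odd}\rangle$ ($s',o'\in Q_k$) with (i) $o'\subseteq s'$; (ii) for all $(\ell,n)\in s$, $\ell'\in\delta(\ell,\sigma)$ there is $n'\le n$ with $(\ell',n')\in s'$; (iii) for all $(\ell,n)\in o$, $\ell'\in\delta(\ell,\sigma)$ there is $n'\le n$ with $(\ell',n')\in o'$; if $o=\emptyset$, it is the set of $\langle s',s'\setminus\mathsf{odd}\rangle$ satisfying (ii). The pre-order $\preceq_{\sf univ}$ on $Q_k\times Q_k$: $\langle s,o\rangle\preceq_{\sf univ}\langle s',o'\rangle$ iff for all $(\ell,n)\in s$ there is $n'\le n$ with $(\ell,n')\in s'$; for all $(\ell,n)\in o$ there is $n'\le n$ with $(\ell,n')\in o'$;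 and $o=\emptyset$ iff $o'=\emptyset$. A pre-order $\preceq$ on the states of an automaton with transition function $\delta'$ and accepting set $\beta$ is a simulation if (1) whenever $x_3\preceq x_1$ and $x_2\in\delta'(x_1,\sigma)$, there is $x_4\preceq x_2$ with $x_4\in\delta'(x_3,\sigma)$; and (2) for all $x\in\beta$, every $x'\preceq x$ lies in $\beta$. -}

module Defs where

open import Data.Nat using (ℕ; suc; _*_; _∸_)
open import Data.Fin using (Fin; toℕ; _≤_)
open import Data.Fin.Subset using (Subset; _∈_; ∣_∣)
open import Data.Vec using (Vec; lookup)
open import Data.Product using (Σ; ∃; _×_; _,_; proj₁)
open import Data.Sum using (_⊎_)
open import Data.Empty using (⊥)
open import Relation.Nullary using (¬_)
open import Relation.Binary.PropositionalEquality using (_≡_)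
open import Relation.Binary.Structures using (IsPreorder)

Odd : ℕ → Set
Odd m = ∃ λ j → m ≡ suc (2 * j)

record NBW (Σ' : Set) : Set where
  field
    n : ℕ
    ι : Fin n
    δ : Fin n → Σ' → Subset n
    α : Subset n

-- Generic automaton structure (states, transition relation, one accepting set);
-- initial states are irrelevant to simulations and are omitted.
record Aut (Σ' : Set) : Set₁ where
  field
    State : Set
    Step  : State → Σ' → State → Set    -- Step x σ y  ⇔  y ∈ δ'(x,σ)
    Acc   : State → Set

record IsSimulation {Σ' : Set} (A : Aut Σ') (_≼_ : Aut.State A → Aut.State A → Set) : Set where
  open Aut A
  field
    preorder : IsPreorder _≡_ _≼_
    step-sim : ∀ x₁ x₂ x₃ σ → x₃ ≼ x₁ → Step x₁ σ x₂ →
               Σ State λ x₄ → x₄ ≼ x₂ × Step x₃ σ x₄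
    acc-sim  : ∀ x x' → Acc x → x' ≼ x → Acc x'

module KVMH {Σ' : Set} (A : NBW Σ') where
  open NBW A

  k : ℕ
  k = 2 * (n ∸ ∣ α ∣)

  Lvl : Set
  Lvl = Fin (suc k)

  OddL : Lvl → Set
  OddL m = Odd (toℕ m)

  -- subsets of Q × [k], row ℓ is the set of levels paired with ℓ
  RSet : Set
  RSet = Vec (Subset (suc k)) n

  Mem : RSet → Fin n → Lvl → Set
  Mem s ℓ m = m ∈ lookup s ℓ

  Valid : RSet → Set
  Valid s = ∀ ℓ m → Mem s ℓ m → ℓ ∈ α → OddL m → ⊥

  Qk : Set
  Qk = Σ RSet Valid

  State : Set
  State = Qk × Qk

  Empty : Qk → Set
  Empty s = ∀ ℓ m → ¬ Mem (proj₁ s) ℓ m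

  Sub : Qk → Qk → Set
  Sub o s = ∀ ℓ m → Mem (proj₁ o) ℓ m → Mem (proj₁ s) ℓ m

  Cover : Qk → Σ' → Qk → Set
  Cover s σ s' = ∀ ℓ m → Mem (proj₁ s) ℓ m → ∀ ℓ' → ℓ' ∈ δ ℓ σ →
                 ∃ λ m' → m' ≤ m × Mem (proj₁ s') ℓ' m'

  IsDiffOdd : Qk → Qk → Set
  IsDiffOdd o' o'' = ∀ ℓ m → (Mem (proj₁ o'') ℓ m → Mem (proj₁ o') ℓ m × ¬ OddL m)
                           × (Mem (proj₁ o') ℓ m × ¬ OddL m → Mem (proj₁ o'') ℓ m)

  Step : State → Σ' → State → Set
  Step (s , o) σ (s' , o'') =
      (¬ Empty o × Σ Qk λ o' → Sub o' s' × Cover s σ s' × Cover o σ o' × IsDiffOdd o' o'')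
    ⊎ (Empty o × Cover s σ s' × IsDiffOdd s' o'')

  Acc : State → Set
  Acc (s , o) = Empty o

  _≼univ_ : State → State → Set
  (s , o) ≼univ (s' , o') =
    (∀ ℓ m → Mem (proj₁ s) ℓ m → ∃ λ m' → m' ≤ m × Mem (proj₁ s') ℓ m')
    × (∀ ℓ m → Mem (proj₁ o) ℓ m → ∃ λ m' → m' ≤ m × Mem (proj₁ o') ℓ m')
    × ((Empty o → Empty o') × (Empty o' → Empty o))

module Product {Σ' : Set} (A₁ A₂ : NBW Σ') where
  module K = KVMH A₂
  open NBW A₁ renaming (n to n₁; δ to δ₁; α to α₁)

  BState : Set
  BState = Fin n₁ × K.State

  BStep : BState → Σ' → BState → Set
  BStep (ℓ₁ , ℓ₂) σ (ℓ₁' , ℓ₂') = ℓ₁' ∈ δ₁ ℓ₁ σ × K.Step ℓ₂ σ ℓ₂'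

  β₁ : BState → Set
  β₁ (ℓ₁ , _) = ℓ₁ ∈ α₁

  β₂ : BState → Set
  β₂ (_ , ℓ₂) = K.Acc ℓ₂

  B₁ : Aut Σ'
  B₁ = record { State = BState ; Step = BStep ; Acc = β₁ }

  B₂ : Aut Σ'
  B₂ = record { State = BState ; Step = BStep ; Acc = β₂ }

  _≼inc_ : BState → BState → Set
  (ℓ₁ , ℓ₂) ≼inc (ℓ₁' , ℓ₂') = ℓ₁ ≡ ℓ₁' × K._≼univ_ ℓ₂ ℓ₂'

module Submission where

-- The argument rests on one observation about the KVMH construction: all of
-- its transition conditions (ii)/(iii) have the form "every successor is
-- covered with a level no larger than ...", so they are preserved when the
-- source set is replaced by one whose levels are dominated by it.  Hence a
-- state that is ≼univ-below another has (at least) all of its successors, and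
-- simulation step (1) holds with the very same successor as witness.

open import Defs
open import Data.Product using (Σ; ∃; _×_; _,_; proj₁)
open import Data.Fin using (_≤_)
open import Data.Fin.Subset using (_∈_)
open import Data.Sum using (inj₁; inj₂)
open import Data.Fin.Properties using (≤-refl; ≤-trans)
open import Relation.Binary.PropositionalEquality
  using (_≡_; refl; trans; subst; sym; isEquivalence)
open import Relation.Binary.Structures using (IsPreorder)

step-sim-of-inherited :
  ∀ {Σ' : Set} (A : Aut Σ') (_≼_ : Aut.State A → Aut.State A → Set) →
  (∀ {x} → x ≼ x) →
  (∀ {x₁ x₂ x₃ σ} → x₃ ≼ x₁ → Aut.Step A x₁ σ x₂ → Aut.Step A x₃ σ x₂) →
  ∀ x₁ x₂ x₃ σ → x₃ ≼ x₁ → Aut.Step A x₁ σ x₂ →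
  Σ (Aut.State A) λ x₄ → x₄ ≼ x₂ × Aut.Step A x₃ σ x₄
step-sim-of-inherited A _≼_ ≼-refl inherit x₁ x₂ x₃ σ x₃≼x₁ step =
  x₂ , ≼-refl , inherit x₃≼x₁ step

module Domination {Σ' : Set} (A : NBW Σ') where
  open KVMH A

  _⊑_ : Qk → Qk → Set
  s ⊑ s' = ∀ ℓ m → Mem (proj₁ s) ℓ m → ∃ λ m' → m' ≤ m × Mem (proj₁ s') ℓ m'

  ⊑-refl : ∀ {s} → s ⊑ s
  ⊑-refl ℓ m p = m , ≤-refl , p

  ⊑-trans : ∀ {s₁ s₂ s₃} → s₁ ⊑ s₂ → s₂ ⊑ s₃ → s₁ ⊑ s₃
  ⊑-trans s₁⊑s₂ s₂⊑s₃ ℓ m p with s₁⊑s₂ ℓ m p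
  ... | m₂ , m₂≤m , p₂ with s₂⊑s₃ ℓ m₂ p₂
  ...   | m₃ , m₃≤m₂ , p₃ = m₃ , ≤-trans m₃≤m₂ m₂≤m , p₃

  Cover-antitone : ∀ {s t σ s'} → t ⊑ s → Cover s σ s' → Cover t σ s'
  Cover-antitone t⊑s cover ℓ m p ℓ' ℓ'∈δ with t⊑s ℓ m p
  ... | m₁ , m₁≤m , p₁ with cover ℓ m₁ p₁ ℓ' ℓ'∈δ
  ...   | m' , m'≤m₁ , p' = m' , ≤-trans m'≤m₁ m₁≤m , p'

  ≼univ-refl : ∀ {x} → x ≼univ x
  ≼univ-refl {s , o} = ⊑-refl {s} , ⊑-refl {o} , (λ e → e) , (λ e → e)

  ≼univ-trans : ∀ {x y z} → x ≼univ y → y ≼univ z → x ≼univ z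
  ≼univ-trans {s₁ , o₁} {s₂ , o₂} {s₃ , o₃}
              (s₁⊑s₂ , o₁⊑o₂ , e₁⇒e₂ , e₂⇒e₁) (s₂⊑s₃ , o₂⊑o₃ , e₂⇒e₃ , e₃⇒e₂) =
    ⊑-trans {s₁} {s₂} {s₃} s₁⊑s₂ s₂⊑s₃ , ⊑-trans {o₁} {o₂} {o₃} o₁⊑o₂ o₂⊑o₃ ,
    (λ e → e₂⇒e₃ (e₁⇒e₂ e)) , (λ e → e₂⇒e₁ (e₃⇒e₂ e))

  -- KVMH transitions are inherited by ≼univ-smaller states: the side condition
  -- (o = ∅ or not) is shared, and both Cover conditions are antitone.
  Step-inherited : ∀ {x₁ x₂ x₃ σ} → x₃ ≼univ x₁ → Step x₁ σ x₂ → Step x₃ σ x₂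
  Step-inherited {s₁ , o₁} {s₂ , o₂} {s₃ , o₃} {σ} (s₃⊑s₁ , o₃⊑o₁ , e₃⇒e₁ , _)
                 (inj₁ (o₁≠∅ , o' , o'⊆s₂ , cover-s , cover-o , o₂≡o'∖odd)) =
    inj₁ ( (λ e → o₁≠∅ (e₃⇒e₁ e)) , o' , o'⊆s₂
         , Cover-antitone {s₁} {s₃} {σ} {s₂} s₃⊑s₁ cover-s
         , Cover-antitone {o₁} {o₃} {σ} {o'} o₃⊑o₁ cover-o , o₂≡o'∖odd )
  Step-inherited {s₁ , o₁} {s₂ , o₂} {s₃ , o₃} {σ} (s₃⊑s₁ , _ , _ , e₁⇒e₃)
                 (inj₂ (o₁=∅ , cover-s , o₂≡s₂∖odd)) =
    inj₂ (e₁⇒e₃ o₁=∅ , Cover-antitone {s₁} {s₃} {σ} {s₂} s₃⊑s₁ cover-s , o₂≡s₂∖odd)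

module Inclusion {Σ' : Set} (A₁ A₂ : NBW Σ') where
  open Product A₁ A₂
  open Domination A₂

  ≼inc-refl : ∀ {x} → x ≼inc x
  ≼inc-refl {ℓ , x} = refl , ≼univ-refl {x}

  ≼inc-isPreorder : IsPreorder _≡_ _≼inc_
  ≼inc-isPreorder = record
    { isEquivalence = isEquivalence
    ; reflexive     = λ { {x} refl → ≼inc-refl {x} }
    ; trans         = λ { {_ , x} {_ , y} {_ , z} (e₁ , x≼y) (e₂ , y≼z) →
                          trans e₁ e₂ , ≼univ-trans {x} {y} {z} x≼y y≼z }
    }

  BStep-inherited : ∀ {x₁ x₂ x₃ σ} → x₃ ≼inc x₁ → BStep x₁ σ x₂ → BStep x₃ σ x₂
  BStep-inherited {_ , k₁} {_ , k₂} {_ , k₃} (refl , k₃≼k₁) (ℓ₂∈δ₁ , k-step) =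
    ℓ₂∈δ₁ , Step-inherited {k₁} {k₂} {k₃} k₃≼k₁ k-step

  B-with : (BState → Set) → Aut Σ'
  B-with Acc = record { State = BState ; Step = BStep ; Acc = Acc }

  ≼inc-simulation : ∀ (Acc : BState → Set) →
    (∀ x x' → Acc x → x' ≼inc x → Acc x') →
    IsSimulation (B-with Acc) _≼inc_
  ≼inc-simulation Acc acc-closed = record
    { preorder = ≼inc-isPreorder
    ; step-sim = step-sim-of-inherited (B-with Acc) _≼inc_
                   (λ {x} → ≼inc-refl {x})
                   (λ {x₁} {x₂} {x₃} → BStep-inherited {x₁} {x₂} {x₃})
    ; acc-sim  = acc-closed
    }

  -- β₁ depends only on the A₁-component, which ≼inc fixes.
  β₁-closed : ∀ x x' → β₁ x → x' ≼inc x → β₁ x'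
  β₁-closed (ℓ , _) (ℓ' , _) ℓ∈α₁ (ℓ'≡ℓ , _) = subst (λ q → q ∈ NBW.α A₁) (sym ℓ'≡ℓ) ℓ∈α₁

  -- β₂ (empty obligation set) is respected since ≼univ preserves emptiness of o.
  β₂-closed : ∀ x x' → β₂ x → x' ≼inc x → β₂ x'
  β₂-closed _ _ o=∅ (_ , _ , _ , _ , o=∅⇒o'=∅) = o=∅⇒o'=∅ o=∅

lemma7p1 : {Σ' : Set} (A₁ A₂ : NBW Σ') →
    IsSimulation (Product.B₁ A₁ A₂) (Product._≼inc_ A₁ A₂)
    × IsSimulation (Product.B₂ A₁ A₂) (Product._≼inc_ A₁ A₂)
lemma7p1 A₁ A₂ =
  ≼inc-simulation (Product.β₁ A₁ A₂) β₁-closed ,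
  ≼inc-simulation (Product.β₂ A₁ A₂) β₂-closed
  where open Inclusion A₁ A₂
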